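{- Let $\lambda$ be a partition with $r$ parts, $\rho=(r-1,\dots,0)$, $\Theta\in\{\Gamma,\Delta\}^r$ with truncation $\Theta'=(\Theta_1,\dots,\Theta_{r-1})$, and let $1\le i\le r-1$ with $\Theta_i\ne\Theta_{i+1}$. If $\mathfrak T\in\mathrm{GTP}^{\Theta'}_{\lambda+\rho}$ then $t_{r-i}\mathfrak T\in\mathrm{GTP}^{(s_i\Theta)'}_{\lambda+\rho}$, where $s_i\Theta$ swaps $\Theta_i$ and $\Theta_{i+1}$ and $(s_i\Theta)'$ is its truncation to the first $r-1$ entries. Moreover, $t_{r-i}\circ\mathrm{sh}_{\Theta'}=\mathrm{sh}_{(s_i\Theta)'}\circ t_{r-i}$ as maps $\mathrm{GTP}_\lambda\to\mathrm{GTP}^{(s_i\Theta)'}_{\lambda+\rho}$.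
   Context: Gelfand–Tsetlin patterns with $r$ rows: arrays $(a_{i,j})_{0\le i\le j\le r-1}$ of nonnegative integers with $a_{i-1,j-1}\ge a_{i,j}\ge a_{i-1,j}$ for all $1\le i\le j\le r-1$. $\mathrm{GTP}_\nu$: those with $a_{0,j}=\nu_{j+1}$. Row pair $(i-1,i)$ has type $\Gamma$ if $a_{i-1,j-1}>a_{i,j}\ge a_{i-1,j}$ for all $j$, type $\Delta$ if $a_{i-1,j-1}\ge a_{i,j}>a_{i-1,j}$ for all $j$; for $\Theta'\in\{\Gamma,\Delta\}^{r-1}$, $\mathrm{GTP}^{\Theta'}_\nu$ consists of patterns whose row pair $(i-1,i)$ has type $\Theta'_i$ for all $i$. Berenstein–Kirillov involution $t_{r-i}$ ($1\le i\le r-1$): it changes only row $i$, replacing each $a_{i,j}$ ($i\le j\le r-1$) by $a'_{i,j}=\min(a_{i-1,j-1},a_{i+1,j})+\max(a_{i-1,j},a_{i+1,j+1})-a_{i,j}$, where any entry $a_{i+1,\cdot}$ that does not exist (i.e. $a_{i+1,i}$, $a_{i+1,r}$, or all of row $i+1$ when $i=r-1$) is omitted from the min or max. Shift map: $\rho^{\Theta'}$ has row $0$ equal to $(r-1,\dots,0)$ and row $i\ge1$ obtained from row $i-1$ by deleting its leftmost entry if $\Theta'_i=\Gamma$ and its rightmost entry if $\Theta'_i=\Delta$; $\mathrm{sh}_{\Theta'}:\mathrm{GTP}_\lambda\to\mathrm{GTP}^{\Theta'}_{\lambda+\rho}$, $\mathfrak T\mapsto\mathfrak T+\rho^{\Theta'}$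 entrywise (a bijection). -}

module Defs where

open import Data.Nat using (ℕ; zero; suc; _+_; _∸_; _≤_; _<_; _≥_; _>_; _⊓_; _⊔_; _≤ᵇ_)
open import Data.Bool using (Bool; true; false; if_then_else_; _∧_)
open import Data.Fin using (Fin; zero; suc; toℕ; inject₁; _≟_)
open import Data.List using (List; []; _∷_; drop; take; length; downFrom)
open import Data.Product using (_×_)
open import Relation.Binary.PropositionalEquality using (_≡_)
open import Relation.Nullary using (does)

-- A Gelfand–Tsetlin pattern with r rows is represented as a function
-- a : ℕ → ℕ → ℕ, where a i j = a_{i,j}; only entries with
-- 0 ≤ i ≤ j ≤ r-1 are meaningful (the others are ignored everywhere).
Pattern : Set
Pattern = ℕ → ℕ → ℕ

_≈[_]_ : Pattern → ℕ → Pattern → Set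
a ≈[ r ] b = ∀ i j → i ≤ j → j ≤ r ∸ 1 → a i j ≡ b i j

Interlacing : ℕ → Pattern → Set
Interlacing r a = ∀ i j → 1 ≤ i → i ≤ j → j ≤ r ∸ 1 →
  (a (i ∸ 1) (j ∸ 1) ≥ a i j) × (a i j ≥ a (i ∸ 1) j)

-- GTP_ν : top row a_{0,j} = ν_{j+1}  (ν_{j+1} is written ν j, j : Fin r).
GTP : (r : ℕ) → (Fin r → ℕ) → Pattern → Set
GTP r ν a = (∀ (j : Fin r) → a 0 (toℕ j) ≡ ν j) × Interlacing r a

data Sym : Set where
  Γ Δ : Sym

HasType : ℕ → Pattern → ℕ → Sym → Set
HasType r a i Γ = ∀ j → i ≤ j → j ≤ r ∸ 1 →
  (a (i ∸ 1) (j ∸ 1) > a i j) × (a i j ≥ a (i ∸ 1) j)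
HasType r a i Δ = ∀ j → i ≤ j → j ≤ r ∸ 1 →
  (a (i ∸ 1) (j ∸ 1) ≥ a i j) × (a i j > a (i ∸ 1) j)

-- A word Θ' ∈ {Γ,Δ}^{r-1} is a function Fin (r-1) → Sym, with
-- Θ'_i = Θ' k where i = toℕ k + 1.
-- GTP^{Θ'}_ν for patterns with r = suc n rows, Θ' ∈ {Γ,Δ}^n.
GTPΘ : (n : ℕ) → (Fin (suc n) → ℕ) → (Fin n → Sym) → Pattern → Set
GTPΘ n ν Θ' a = GTP (suc n) ν a × (∀ (k : Fin n) → HasType (suc n) a (suc (toℕ k)) (Θ' k))

trunc : ∀ {n} → (Fin (suc n) → Sym) → (Fin n → Sym)
trunc Θ k = Θ (inject₁ k)

-- s_i Θ: swap Θ_i and Θ_{i+1}, where i = toℕ k + 1 (k : Fin n, r = suc n),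
-- i.e. swap the 0-based positions inject₁ k and suc k.
swapΘ : ∀ {n} → Fin n → (Fin (suc n) → Sym) → (Fin (suc n) → Sym)
swapΘ k Θ p =
  if does (p ≟ inject₁ k) then Θ (suc k)
  else if does (p ≟ suc k) then Θ (inject₁ k)
  else Θ p

plusRho : ∀ n → (Fin (suc n) → ℕ) → (Fin (suc n) → ℕ)
plusRho n ν j = ν j + (n ∸ toℕ j)

IsPartition : ∀ n → (Fin (suc n) → ℕ) → Set
IsPartition n ν = ∀ (k : Fin n) → ν (suc k) ≤ ν (inject₁ k)

-- Berenstein–Kirillov involution t_{r-i}, acting on row i (1 ≤ i ≤ r-1).
-- bk r i a  is  t_{r-i} a.

-- a_{i+1,j} exists iff i+1 ≤ j ≤ r-1;  a_{i+1,j+1} exists iff i ≤ j and j+1 ≤ r-1.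
bkEntry : ℕ → ℕ → Pattern → ℕ → ℕ
bkEntry r i a j = (mn + mx) ∸ a i j
  where
  mn : ℕ
  mn = if (suc i ≤ᵇ j) ∧ (j ≤ᵇ r ∸ 1)
       then a (i ∸ 1) (j ∸ 1) ⊓ a (suc i) j
       else a (i ∸ 1) (j ∸ 1)
  mx : ℕ
  mx = if (i ≤ᵇ j) ∧ (suc j ≤ᵇ r ∸ 1)
       then a (i ∸ 1) j ⊔ a (suc i) (suc j)
       else a (i ∸ 1) j

bk : (r i : ℕ) → Pattern → Pattern
bk r i a p j = if (p ≤ᵇ i) ∧ (i ≤ᵇ p) then bkEntry r i a j else a p j

nth : List ℕ → ℕ → ℕ
nth []       _       = 0
nth (x ∷ _)  zero    = x
nth (_ ∷ xs) (suc j) = nth xs j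

symAt : ∀ {n} → (Fin n → Sym) → ℕ → Sym
symAt {zero}  Θ' _       = Γ
symAt {suc n} Θ' zero    = Θ' zero
symAt {suc n} Θ' (suc i) = symAt (λ k → Θ' (suc k)) i

deleteBy : Sym → List ℕ → List ℕ
deleteBy Γ xs = drop 1 xs
deleteBy Δ xs = take (length xs ∸ 1) xs

-- rhoRow r Θ' i : row i of ρ^{Θ'}; Θ'_{i+1} = symAt Θ' i.
rhoRow : ∀ {n} → (Fin n → Sym) → ℕ → List ℕ
rhoRow {n} Θ' zero    = downFrom (suc n)
rhoRow {n} Θ' (suc i) = deleteBy (symAt Θ' i) (rhoRow Θ' i)

rho : ∀ {n} → (Fin n → Sym) → Pattern
rho Θ' i j = nth (rhoRow Θ' i) (j ∸ i)

sh : ∀ {n} → (Fin n → Sym) → Pattern → Pattern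
sh Θ' T i j = T i j + rho Θ' i j

-- Writing D(p) for the number of Δ among Θ'_1,…,Θ'_p, the shift is ρ^{Θ'}_{p,j} = (r−1−j) + D(p).
-- Exchanging Θ_i ≠ Θ_{i+1} changes D only at p = i.  In column j, with K = (r−1−j) + D(i−1), the
-- entries inside the min of t_{r−i} are shifted by K + 1, those inside the max by K, and a_{i,j} by
-- K + [Θ_i = Δ] before and K + [Θ_{i+1} = Δ] after the exchange; these add up to 2K + 1, so
-- t_{r−i} commutes with the shifts.
-- For the types: x ↦ min + max − x maps [max, min] onto itself and turns a half-open interval into
-- the oppositely half-open one, which exchanges the types Γ and Δ of the two row pairs adjacent to
-- row i.
module Submission where

open import Defs
open import Data.Nat using (ℕ)
open import Data.Nat as ℕ using ()
open import Data.Fin using (Fin; toℕ; inject₁; suc)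
open import Data.Product using (_×_)
open import Relation.Binary.PropositionalEquality using (_≢_)

open import Data.Bool using (Bool; true; false; if_then_else_; _∧_; T)
open import Data.Bool.Properties using (T-∧; T-≡)
open import Data.Empty using (⊥-elim)
open import Data.Fin using (zero; fromℕ<) renaming (_≟_ to _≟ᶠ_)
open import Data.Fin.Properties using (toℕ-inject₁; toℕ<n; toℕ-fromℕ<)
open import Data.List using (List; []; _∷_; downFrom; length; take)
open import Data.Nat using (zero; suc; pred; _+_; _∸_; _≤_; _<_; _≥_; _⊓_; _⊔_; _≤ᵇ_; z≤n; s≤s; _≟_)
open import Data.Nat.Properties
open import Data.Nat.Tactic.RingSolver using (solve-∀)
open import Data.Product using (_,_; proj₁; proj₂)
open import Function.Base using (_∘_)
open import Function.Bundles using (Equivalence)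
open import Relation.Binary.PropositionalEquality
  using (_≡_; refl; sym; trans; cong; cong₂; subst; subst₂; ≢-sym; module ≡-Reasoning)
open import Relation.Nullary using (yes; no; ofʸ)
open import Relation.Nullary.Decidable using (dec-true; dec-false)

reflect-≤<⇒<≤ : ∀ {l x u} → l ≤ x → x < u → l < u + l ∸ x × u + l ∸ x ≤ u
reflect-≤<⇒<≤ {l} {x} {u} l≤x x<u rewrite +-∸-comm l (<⇒≤ x<u) =
  m<n+m l (m<n⇒0<n∸m x<u) , ≤-trans (+-monoʳ-≤ (u ∸ x) l≤x) (≤-reflexive (m∸n+n≡m (<⇒≤ x<u)))

reflect-<≤⇒≤< : ∀ {l x u} → l < x → x ≤ u → l ≤ u + l ∸ x × u + l ∸ x < u
reflect-<≤⇒≤< {l} {x} {u} l<x x≤u rewrite +-∸-comm l x≤u =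
  m≤n+m l (u ∸ x) , <-≤-trans (+-monoʳ-< (u ∸ x) l<x) (≤-reflexive (m∸n+n≡m x≤u))

reflect-shift : ∀ {u l x} s t z w → x ≤ u → z + w ≡ s + t →
  (u + s) + (l + t) ∸ (x + z) ≡ (u + l ∸ x) + w
reflect-shift {u} {l} {x} s t z w x≤u z+w≡s+t = begin
  (u + s) + (l + t) ∸ (x + z)  ≡⟨ cong (_∸ (x + z)) regroup ⟩
  (v + w) + (x + z) ∸ (x + z)  ≡⟨ m+n∸n≡m (v + w) (x + z) ⟩
  v + w                         ∎
  where
  open ≡-Reasoning
  v : ℕ
  v = u + l ∸ x
  interchange : ∀ a b c d → (a + b) + (c + d) ≡ (a + c) + (b + d)
  interchange = solve-∀
  rotate : ∀ a b c d → (a + b) + (c + d) ≡ (a + d) + (b + c)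
  rotate = solve-∀
  regroup : (u + s) + (l + t) ≡ (v + w) + (x + z)
  regroup = begin
    (u + s) + (l + t)  ≡⟨ interchange u s l t ⟩
    (u + l) + (s + t)  ≡⟨ cong₂ _+_ (sym (m∸n+n≡m (m≤n⇒m≤n+o l x≤u))) (sym z+w≡s+t) ⟩
    (v + x) + (z + w)  ≡⟨ rotate v x z w ⟩
    (v + w) + (x + z)  ∎

complementary-shifts : ∀ {d d′} c e → d + d′ ≡ 1 →
  (c + (d + e)) + (c + (d′ + e)) ≡ suc (c + e) + (c + e)
complementary-shifts {d} {d′} c e d+d′≡1 =
  trans (regroup c d d′ e) (cong (λ t → t + (c + e) + (c + e)) d+d′≡1)
  where
  regroup : ∀ c d d′ e → (c + (d + e)) + (c + (d′ + e)) ≡ (d + d′) + (c + e) + (c + e)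
  regroup = solve-∀

δ : Sym → ℕ
δ Γ = 0
δ Δ = 1

δ-distinct : ∀ {s s′} → s ≢ s′ → δ s + δ s′ ≡ 1
δ-distinct {Γ} {Γ} s≢s′ = ⊥-elim (s≢s′ refl)
δ-distinct {Γ} {Δ} _    = refl
δ-distinct {Δ} {Γ} _    = refl
δ-distinct {Δ} {Δ} s≢s′ = ⊥-elim (s≢s′ refl)

countΔ : (ℕ → Sym) → ℕ → ℕ
countΔ f zero    = 0
countΔ f (suc p) = δ (f p) + countΔ f p

countΔ-cong : ∀ {f g} p → (∀ q → q < p → f q ≡ g q) → countΔ f p ≡ countΔ g p
countΔ-cong zero    _   = refl
countΔ-cong (suc p) f≡g =
  cong₂ _+_ (cong δ (f≡g p ≤-refl)) (countΔ-cong p (λ q q<p → f≡g q (m<n⇒m<1+n q<p)))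

countΔ-step² : ∀ f m → f m ≢ f (suc m) → countΔ f (suc (suc m)) ≡ suc (countΔ f m)
countΔ-step² f m fm≢fm+1 = begin
  δ (f (suc m)) + (δ (f m) + countΔ f m)  ≡⟨ sym (+-assoc (δ (f (suc m))) _ _) ⟩
  (δ (f (suc m)) + δ (f m)) + countΔ f m  ≡⟨ cong (_+ countΔ f m) (δ-distinct (≢-sym fm≢fm+1)) ⟩
  suc (countΔ f m)                         ∎
  where open ≡-Reasoning

record AdjacentSwap (m : ℕ) (f g : ℕ → Sym) : Set where
  field
    at-m      : g m ≡ f (suc m)
    at-suc-m  : g (suc m) ≡ f m
    elsewhere : ∀ q → q ≢ m → q ≢ suc m → g q ≡ f q

countΔ-swap : ∀ {m f g} → AdjacentSwap m f g → ∀ p → p ≢ suc m → countΔ g p ≡ countΔ f p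
countΔ-swap sw zero _ = refl
countΔ-swap {m} {f} {g} sw (suc p) p+1≢m+1 with p ≟ m | p ≟ suc m
... | yes refl | _ = ⊥-elim (p+1≢m+1 refl)
... | no _ | yes refl = begin
  δ (g (suc m)) + (δ (g m) + countΔ g m)
    ≡⟨ cong₂ (λ s s′ → δ s + (δ s′ + countΔ g m)) at-suc-m at-m ⟩
  δ (f m) + (δ (f (suc m)) + countΔ g m)
    ≡⟨ cong (λ c → δ (f m) + (δ (f (suc m)) + c)) (countΔ-swap sw m (≢-sym 1+n≢n)) ⟩
  δ (f m) + (δ (f (suc m)) + countΔ f m)
    ≡⟨ +-exchange (δ (f m)) (δ (f (suc m))) (countΔ f m) ⟩
  δ (f (suc m)) + (δ (f m) + countΔ f m)
    ∎
  where
  open ≡-Reasoning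
  open AdjacentSwap sw
  +-exchange : ∀ a b c → a + (b + c) ≡ b + (a + c)
  +-exchange = solve-∀
... | no p≢m | no p≢m+1 =
  cong₂ _+_ (cong δ (AdjacentSwap.elsewhere sw p p≢m p≢m+1)) (countΔ-swap sw p p≢m+1)

symAt-toℕ : ∀ {n} (Θ : Fin n → Sym) (f : Fin n) → symAt Θ (toℕ f) ≡ Θ f
symAt-toℕ Θ zero    = refl
symAt-toℕ Θ (suc f) = symAt-toℕ (λ k → Θ (suc k)) f

symAt-pointwise : ∀ {n} {Θ Θ′ : Fin n → Sym} q → (∀ f → toℕ f ≡ q → Θ f ≡ Θ′ f) →
  symAt Θ q ≡ symAt Θ′ q
symAt-pointwise {zero}  q       _     = refl
symAt-pointwise {suc n} zero    agree = agree zero refl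
symAt-pointwise {suc n} (suc q) agree = symAt-pointwise q (λ f e → agree (suc f) (cong suc e))

symAt-trunc : ∀ {n} (Θ : Fin (suc n) → Sym) q → q < n → symAt (trunc Θ) q ≡ symAt Θ q
symAt-trunc {suc n} Θ zero    _         = refl
symAt-trunc {suc n} Θ (suc q) (s≤s q<n) = symAt-trunc (λ k → Θ (suc k)) q q<n

symAt-inject₁ : ∀ {n} (Θ : Fin (suc n) → Sym) (k : Fin n) → symAt Θ (toℕ k) ≡ Θ (inject₁ k)
symAt-inject₁ Θ k = trans (sym (symAt-trunc Θ (toℕ k) (toℕ<n k))) (symAt-toℕ (trunc Θ) k)

suc≢inject₁ : ∀ {n} (k : Fin n) → suc k ≢ inject₁ k
suc≢inject₁ k e = 1+n≢n (trans (cong toℕ e) (toℕ-inject₁ k))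

swapΘ-inject₁ : ∀ {n} (k : Fin n) Θ → swapΘ k Θ (inject₁ k) ≡ Θ (suc k)
swapΘ-inject₁ k Θ rewrite dec-true (inject₁ k ≟ᶠ inject₁ k) refl = refl

swapΘ-suc : ∀ {n} (k : Fin n) Θ → swapΘ k Θ (suc k) ≡ Θ (inject₁ k)
swapΘ-suc k Θ
  rewrite dec-false (suc k ≟ᶠ inject₁ k) (suc≢inject₁ k) | dec-true (suc k ≟ᶠ suc k) refl = refl

swapΘ-other : ∀ {n} (k : Fin n) Θ f → f ≢ inject₁ k → f ≢ suc k → swapΘ k Θ f ≡ Θ f
swapΘ-other k Θ f f≢k f≢k+1
  rewrite dec-false (f ≟ᶠ inject₁ k) f≢k | dec-false (f ≟ᶠ suc k) f≢k+1 = refl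

symAt-swapΘ : ∀ {n} (k : Fin n) Θ → AdjacentSwap (toℕ k) (symAt Θ) (symAt (swapΘ k Θ))
symAt-swapΘ k Θ = record
  { at-m      = trans (symAt-inject₁ (swapΘ k Θ) k)
                  (trans (swapΘ-inject₁ k Θ) (sym (symAt-toℕ Θ (suc k))))
  ; at-suc-m  = trans (symAt-toℕ (swapΘ k Θ) (suc k))
                  (trans (swapΘ-suc k Θ) (sym (symAt-inject₁ Θ k)))
  ; elsewhere = λ q q≢m q≢m+1 → symAt-pointwise q λ f toℕf≡q → swapΘ-other k Θ f
                  (λ f≡k → q≢m (trans (sym toℕf≡q) (trans (cong toℕ f≡k) (toℕ-inject₁ k))))
                  (λ f≡k+1 → q≢m+1 (trans (sym toℕf≡q) (cong toℕ f≡k+1)))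
  }

offsetDownFrom : ℕ → ℕ → List ℕ
offsetDownFrom zero    b = []
offsetDownFrom (suc l) b = (l + b) ∷ offsetDownFrom l b

downFrom≡offsetDownFrom : ∀ l → downFrom l ≡ offsetDownFrom l 0
downFrom≡offsetDownFrom zero    = refl
downFrom≡offsetDownFrom (suc l) = cong₂ _∷_ (sym (+-identityʳ l)) (downFrom≡offsetDownFrom l)

length-offsetDownFrom : ∀ l b → length (offsetDownFrom l b) ≡ l
length-offsetDownFrom zero    b = refl
length-offsetDownFrom (suc l) b = cong suc (length-offsetDownFrom l b)

take-offsetDownFrom : ∀ l b → take l (offsetDownFrom (suc l) b) ≡ offsetDownFrom l (suc b)
take-offsetDownFrom zero    b = refl
take-offsetDownFrom (suc l) b = cong₂ _∷_ (sym (+-suc l b)) (take-offsetDownFrom l b)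

deleteBy-offsetDownFrom : ∀ s l b → deleteBy s (offsetDownFrom l b) ≡ offsetDownFrom (pred l) (δ s + b)
deleteBy-offsetDownFrom Γ zero    b = refl
deleteBy-offsetDownFrom Γ (suc l) b = refl
deleteBy-offsetDownFrom Δ zero    b = refl
deleteBy-offsetDownFrom Δ (suc l) b rewrite length-offsetDownFrom l b = take-offsetDownFrom l b

nth-offsetDownFrom : ∀ {l} b q → q < l → nth (offsetDownFrom l b) q ≡ (l ∸ suc q) + b
nth-offsetDownFrom {suc l} b zero    _         = refl
nth-offsetDownFrom {suc l} b (suc q) (s≤s q<l) = nth-offsetDownFrom b q q<l

rhoRow-offsetDownFrom : ∀ {n} (Θ′ : Fin n → Sym) p →
  rhoRow Θ′ p ≡ offsetDownFrom (suc n ∸ p) (countΔ (symAt Θ′) p)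
rhoRow-offsetDownFrom {n} Θ′ zero    = downFrom≡offsetDownFrom (suc n)
rhoRow-offsetDownFrom {n} Θ′ (suc p) = begin
  deleteBy (symAt Θ′ p) (rhoRow Θ′ p)
    ≡⟨ cong (deleteBy (symAt Θ′ p)) (rhoRow-offsetDownFrom Θ′ p) ⟩
  deleteBy (symAt Θ′ p) (offsetDownFrom (suc n ∸ p) (countΔ (symAt Θ′) p))
    ≡⟨ deleteBy-offsetDownFrom (symAt Θ′ p) (suc n ∸ p) _ ⟩
  offsetDownFrom (pred (suc n ∸ p)) (countΔ (symAt Θ′) (suc p))
    ≡⟨ cong (λ l → offsetDownFrom l (countΔ (symAt Θ′) (suc p))) (pred[m∸n]≡m∸[1+n] (suc n) p) ⟩
  offsetDownFrom (suc n ∸ suc p) (countΔ (symAt Θ′) (suc p))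
    ∎
  where open ≡-Reasoning

rho-formula : ∀ {n} (Θ′ : Fin n → Sym) p j → p ≤ j → j ≤ n →
  rho Θ′ p j ≡ (n ∸ j) + countΔ (symAt Θ′) p
rho-formula {n} Θ′ p j p≤j j≤n = begin
  nth (rhoRow Θ′ p) (j ∸ p)
    ≡⟨ cong (λ row → nth row (j ∸ p)) (rhoRow-offsetDownFrom Θ′ p) ⟩
  nth (offsetDownFrom (suc n ∸ p) (countΔ (symAt Θ′) p)) (j ∸ p)
    ≡⟨ nth-offsetDownFrom _ (j ∸ p) (∸-monoˡ-< (s≤s j≤n) p≤j) ⟩
  (suc n ∸ p ∸ suc (j ∸ p)) + countΔ (symAt Θ′) p
    ≡⟨ cong (_+ countΔ (symAt Θ′) p) column ⟩
  (n ∸ j) + countΔ (symAt Θ′) p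
    ∎
  where
  open ≡-Reasoning
  column : suc n ∸ p ∸ suc (j ∸ p) ≡ n ∸ j
  column = begin
    suc n ∸ p ∸ suc (j ∸ p)    ≡⟨ ∸-+-assoc (suc n) p (suc (j ∸ p)) ⟩
    suc n ∸ (p + suc (j ∸ p))  ≡⟨ cong (suc n ∸_) (+-suc p (j ∸ p)) ⟩
    n ∸ (p + (j ∸ p))          ≡⟨ cong (n ∸_) (m+[n∸m]≡n p≤j) ⟩
    n ∸ j                      ∎

rho-trunc : ∀ {n} (Θ : Fin (suc n) → Sym) p j → p ≤ j → j ≤ n →
  rho (trunc Θ) p j ≡ (n ∸ j) + countΔ (symAt Θ) p
rho-trunc Θ p j p≤j j≤n = trans (rho-formula (trunc Θ) p j p≤j j≤n)
  (cong (_ +_) (countΔ-cong p (λ q q<p → symAt-trunc Θ q (<-≤-trans q<p (≤-trans p≤j j≤n)))))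

_⊓⟨_⟩_ : ℕ → Bool → ℕ → ℕ
x ⊓⟨ c ⟩ y = if c then x ⊓ y else x

_⊔⟨_⟩_ : ℕ → Bool → ℕ → ℕ
x ⊔⟨ c ⟩ y = if c then x ⊔ y else x

⊓⟨⟩-≤ˡ : ∀ c x y → x ⊓⟨ c ⟩ y ≤ x
⊓⟨⟩-≤ˡ true  x y = m⊓n≤m x y
⊓⟨⟩-≤ˡ false x y = ≤-refl

⊓⟨⟩-≤ʳ : ∀ c x y → T c → x ⊓⟨ c ⟩ y ≤ y
⊓⟨⟩-≤ʳ true x y _ = m⊓n≤n x y

⊓⟨⟩-glb : ∀ c {m x y} → m ≤ x → (T c → m ≤ y) → m ≤ x ⊓⟨ c ⟩ y
⊓⟨⟩-glb true  m≤x m≤y = ⊓-glb m≤x (m≤y _)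
⊓⟨⟩-glb false m≤x _   = m≤x

⊓⟨⟩-+ : ∀ c x y {s s′ t} → s ≡ t → (T c → s′ ≡ t) → (x + s) ⊓⟨ c ⟩ (y + s′) ≡ (x ⊓⟨ c ⟩ y) + t
⊓⟨⟩-+ true  x y {t = t} refl s′≡t rewrite s′≡t _ = sym (+-distribʳ-⊓ t x y)
⊓⟨⟩-+ false x y         refl _    = refl

⊔⟨⟩-≥ˡ : ∀ c x y → x ≤ x ⊔⟨ c ⟩ y
⊔⟨⟩-≥ˡ true  x y = m≤m⊔n x y
⊔⟨⟩-≥ˡ false x y = ≤-refl

⊔⟨⟩-≥ʳ : ∀ c x y → T c → y ≤ x ⊔⟨ c ⟩ y
⊔⟨⟩-≥ʳ true x y _ = m≤n⊔m x y

⊔⟨⟩-lub : ∀ c {m x y} → x ≤ m → (T c → y ≤ m) → x ⊔⟨ c ⟩ y ≤ m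
⊔⟨⟩-lub true  x≤m y≤m = ⊔-lub x≤m (y≤m _)
⊔⟨⟩-lub false x≤m _   = x≤m

⊔⟨⟩-<-lub : ∀ c {m x y} → x < m → (T c → y < m) → x ⊔⟨ c ⟩ y < m
⊔⟨⟩-<-lub true  x<m y<m = ⊔-lub x<m (y<m _)
⊔⟨⟩-<-lub false x<m _   = x<m

⊔⟨⟩-+ : ∀ c x y {s s′ t} → s ≡ t → (T c → s′ ≡ t) → (x + s) ⊔⟨ c ⟩ (y + s′) ≡ (x ⊔⟨ c ⟩ y) + t
⊔⟨⟩-+ true  x y {t = t} refl s′≡t rewrite s′≡t _ = sym (+-distribʳ-⊔ t x y)
⊔⟨⟩-+ false x y         refl _    = refl

T-≤ᵇ∧≤ᵇ : ∀ {a b c d} → T ((a ≤ᵇ b) ∧ (c ≤ᵇ d)) → a ≤ b × c ≤ d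
T-≤ᵇ∧≤ᵇ {a} {b} {c} {d} t with Equivalence.to T-∧ t
... | a≤ᵇb , c≤ᵇd = ≤ᵇ⇒≤ a b a≤ᵇb , ≤ᵇ⇒≤ c d c≤ᵇd

≤∧≤⇒T-≤ᵇ∧≤ᵇ : ∀ {a b c d} → a ≤ b → c ≤ d → T ((a ≤ᵇ b) ∧ (c ≤ᵇ d))
≤∧≤⇒T-≤ᵇ∧≤ᵇ a≤b c≤d = Equivalence.from T-∧ (≤⇒≤ᵇ a≤b , ≤⇒≤ᵇ c≤d)

-- Definitionally the mn and mx of bkEntry.
upper lower : ℕ → ℕ → Pattern → ℕ → ℕ
upper r i a j = a (i ∸ 1) (j ∸ 1) ⊓⟨ (suc i ≤ᵇ j) ∧ (j ≤ᵇ r ∸ 1) ⟩ a (suc i) j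
lower r i a j = a (i ∸ 1) j ⊔⟨ (i ≤ᵇ j) ∧ (suc j ≤ᵇ r ∸ 1) ⟩ a (suc i) (suc j)

module Neighbours (r i : ℕ) (a : Pattern) where

  upper≤above : ∀ j → upper r i a j ≤ a (i ∸ 1) (j ∸ 1)
  upper≤above j = ⊓⟨⟩-≤ˡ _ _ _

  upper≤below : ∀ j → suc i ≤ j → j ≤ r ∸ 1 → upper r i a j ≤ a (suc i) j
  upper≤below j i<j j≤r-1 = ⊓⟨⟩-≤ʳ _ _ _ (≤∧≤⇒T-≤ᵇ∧≤ᵇ i<j j≤r-1)

  upper-glb : ∀ j {m} → m ≤ a (i ∸ 1) (j ∸ 1) → (suc i ≤ j → j ≤ r ∸ 1 → m ≤ a (suc i) j) →
    m ≤ upper r i a j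
  upper-glb j m≤above m≤below =
    ⊓⟨⟩-glb _ m≤above (λ t → let (i<j , j≤r-1) = T-≤ᵇ∧≤ᵇ t in m≤below i<j j≤r-1)

  above≤lower : ∀ j → a (i ∸ 1) j ≤ lower r i a j
  above≤lower j = ⊔⟨⟩-≥ˡ _ _ _

  below≤lower : ∀ j → i ≤ j → suc j ≤ r ∸ 1 → a (suc i) (suc j) ≤ lower r i a j
  below≤lower j i≤j j<r-1 = ⊔⟨⟩-≥ʳ _ _ _ (≤∧≤⇒T-≤ᵇ∧≤ᵇ i≤j j<r-1)

  lower-lub : ∀ j {m} → a (i ∸ 1) j ≤ m → (i ≤ j → suc j ≤ r ∸ 1 → a (suc i) (suc j) ≤ m) →
    lower r i a j ≤ m
  lower-lub j above≤m below≤m =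
    ⊔⟨⟩-lub _ above≤m (λ t → let (i≤j , j<r-1) = T-≤ᵇ∧≤ᵇ t in below≤m i≤j j<r-1)

  lower-<-lub : ∀ j {m} → a (i ∸ 1) j < m → (i ≤ j → suc j ≤ r ∸ 1 → a (suc i) (suc j) < m) →
    lower r i a j < m
  lower-<-lub j above<m below<m =
    ⊔⟨⟩-<-lub _ above<m (λ t → let (i≤j , j<r-1) = T-≤ᵇ∧≤ᵇ t in below<m i≤j j<r-1)

bk-row : ∀ r i a j → bk r i a i j ≡ bkEntry r i a j
bk-row r i a j rewrite Equivalence.to T-≡ (≤⇒≤ᵇ (≤-refl {i})) = refl

bk-otherRow : ∀ r i a p j → p ≢ i → bk r i a p j ≡ a p j
bk-otherRow r i a p j p≢i with p ≤ᵇ i | ≤ᵇ-reflects-≤ p i | i ≤ᵇ p | ≤ᵇ-reflects-≤ i p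
... | true  | ofʸ p≤i | true  | ofʸ i≤p = ⊥-elim (p≢i (≤-antisym p≤i i≤p))
... | true  | _       | false | _       = refl
... | false | _       | _     | _       = refl

HasType⇒interlaced : ∀ {r a i} s → HasType r a i s → ∀ j → i ≤ j → j ≤ r ∸ 1 →
  (a (i ∸ 1) (j ∸ 1) ≥ a i j) × (a i j ≥ a (i ∸ 1) j)
HasType⇒interlaced Γ H j i≤j j≤r-1 = <⇒≤ (proj₁ (H j i≤j j≤r-1)) , proj₂ (H j i≤j j≤r-1)
HasType⇒interlaced Δ H j i≤j j≤r-1 = proj₁ (H j i≤j j≤r-1) , <⇒≤ (proj₂ (H j i≤j j≤r-1))

HasType-cong : ∀ {r a b i} s → (∀ j → a (i ∸ 1) j ≡ b (i ∸ 1) j) → (∀ j → a i j ≡ b i j) →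
  HasType r a i s → HasType r b i s
HasType-cong Γ above below H j i≤j j≤r-1 =
  subst₂ _<_ (below j) (above (j ∸ 1)) (proj₁ (H j i≤j j≤r-1)) ,
  subst₂ _≤_ (above j) (below j) (proj₂ (H j i≤j j≤r-1))
HasType-cong Δ above below H j i≤j j≤r-1 =
  subst₂ _≤_ (below j) (above (j ∸ 1)) (proj₁ (H j i≤j j≤r-1)) ,
  subst₂ _<_ (above j) (below j) (proj₂ (H j i≤j j≤r-1))

module _ (n m : ℕ) (a : Pattern) where
  private
    r i : ℕ
    r = suc n
    i = suc m
    a′ : Pattern
    a′ = bk r i a
    E : ℕ → ℕ
    E = bkEntry r i a
    row : ∀ j → E j ≡ a′ i j
    row j = sym (bk-row r i a j)
    above : ∀ j → a m j ≡ a′ m j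
    above j = sym (bk-otherRow r i a m j (≢-sym 1+n≢n))
    below : ∀ j → a (suc i) j ≡ a′ (suc i) j
    below j = sym (bk-otherRow r i a (suc i) j 1+n≢n)
  open Neighbours r i a

  bk-exchangesTypes : ∀ {s s′} → s ≢ s′ → HasType r a i s → (i < n → HasType r a (suc i) s′) →
    HasType r a′ i s′ × (i < n → HasType r a′ (suc i) s)
  bk-exchangesTypes {Γ} {Γ} Γ≢Γ _ _ = ⊥-elim (Γ≢Γ refl)
  bk-exchangesTypes {Δ} {Δ} Δ≢Δ _ _ = ⊥-elim (Δ≢Δ refl)
  bk-exchangesTypes {Γ} {Δ} _ Hᵢ Hᵢ₊₁ = Hᵢ′ , Hᵢ₊₁′
    where
    bounds : ∀ j → i ≤ j → j ≤ n → lower r i a j < E j × E j ≤ upper r i a j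
    bounds j i≤j j≤n = reflect-≤<⇒<≤
      (lower-lub j (proj₂ (Hᵢ j i≤j j≤n))
        (λ i≤j j<n → proj₁ (Hᵢ₊₁ (≤-trans (s≤s i≤j) j<n) (suc j) (s≤s i≤j) j<n)))
      (upper-glb j (proj₁ (Hᵢ j i≤j j≤n))
        (λ i<j j≤n → proj₂ (Hᵢ₊₁ (≤-trans i<j j≤n) j i<j j≤n)))
    Hᵢ′ : HasType r a′ i Δ
    Hᵢ′ j i≤j j≤n =
      subst₂ _≤_ (row j) (above (j ∸ 1)) (≤-trans (proj₂ (bounds j i≤j j≤n)) (upper≤above j)) ,
      subst₂ _<_ (above j) (row j) (≤-<-trans (above≤lower j) (proj₁ (bounds j i≤j j≤n)))
    Hᵢ₊₁′ : i < n → HasType r a′ (suc i) Γ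
    Hᵢ₊₁′ _ (suc j) (s≤s i≤j) j<n =
      subst₂ _<_ (below (suc j)) (row j)
        (≤-<-trans (below≤lower j i≤j j<n) (proj₁ (bounds j i≤j (<⇒≤ j<n)))) ,
      subst₂ _≤_ (row (suc j)) (below (suc j))
        (≤-trans (proj₂ (bounds (suc j) (m≤n⇒m≤1+n i≤j) j<n)) (upper≤below (suc j) (s≤s i≤j) j<n))
  bk-exchangesTypes {Δ} {Γ} _ Hᵢ Hᵢ₊₁ = Hᵢ′ , Hᵢ₊₁′
    where
    bounds : ∀ j → i ≤ j → j ≤ n → lower r i a j ≤ E j × E j < upper r i a j
    bounds j i≤j j≤n = reflect-<≤⇒≤<
      (lower-<-lub j (proj₂ (Hᵢ j i≤j j≤n))
        (λ i≤j j<n → proj₁ (Hᵢ₊₁ (≤-trans (s≤s i≤j) j<n) (suc j) (s≤s i≤j) j<n)))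
      (upper-glb j (proj₁ (Hᵢ j i≤j j≤n))
        (λ i<j j≤n → proj₂ (Hᵢ₊₁ (≤-trans i<j j≤n) j i<j j≤n)))
    Hᵢ′ : HasType r a′ i Γ
    Hᵢ′ j i≤j j≤n =
      subst₂ _<_ (row j) (above (j ∸ 1)) (<-≤-trans (proj₂ (bounds j i≤j j≤n)) (upper≤above j)) ,
      subst₂ _≤_ (above j) (row j) (≤-trans (above≤lower j) (proj₁ (bounds j i≤j j≤n)))
    Hᵢ₊₁′ : i < n → HasType r a′ (suc i) Δ
    Hᵢ₊₁′ _ (suc j) (s≤s i≤j) j<n =
      subst₂ _≤_ (below (suc j)) (row j)
        (≤-trans (below≤lower j i≤j j<n) (proj₁ (bounds j i≤j (<⇒≤ j<n)))) ,
      subst₂ _<_ (row (suc j)) (below (suc j))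
        (<-≤-trans (proj₂ (bounds (suc j) (m≤n⇒m≤1+n i≤j) j<n)) (upper≤below (suc j) (s≤s i≤j) j<n))

bkEntry-shift : ∀ r i (a s : Pattern) j {x y z w} → a i j ≤ upper r i a j →
  s (i ∸ 1) (j ∸ 1) ≡ x → (suc i ≤ j → j ≤ r ∸ 1 → s (suc i) j ≡ x) →
  s (i ∸ 1) j ≡ y → (i ≤ j → suc j ≤ r ∸ 1 → s (suc i) (suc j) ≡ y) →
  s i j ≡ z → z + w ≡ x + y →
  bkEntry r i (λ p q → a p q + s p q) j ≡ bkEntry r i a j + w
bkEntry-shift r i a s j {x} {y} {z} {w} aᵢⱼ≤upper sx sx′ sy sy′ sz z+w≡x+y = begin
  upper r i a+s j + lower r i a+s j ∸ (a i j + s i j)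
    ≡⟨ cong₂ _∸_ (cong₂ _+_ upper-shift lower-shift) (cong (a i j +_) sz) ⟩
  (upper r i a j + x) + (lower r i a j + y) ∸ (a i j + z)
    ≡⟨ reflect-shift x y z w aᵢⱼ≤upper z+w≡x+y ⟩
  bkEntry r i a j + w
    ∎
  where
  open ≡-Reasoning
  a+s : Pattern
  a+s p q = a p q + s p q
  upper-shift : upper r i a+s j ≡ upper r i a j + x
  upper-shift = ⊓⟨⟩-+ _ _ _ sx (λ t → let (i<j , j≤r-1) = T-≤ᵇ∧≤ᵇ t in sx′ i<j j≤r-1)
  lower-shift : lower r i a+s j ≡ lower r i a j + y
  lower-shift = ⊔⟨⟩-+ _ _ _ sy (λ t → let (i≤j , j<r-1) = T-≤ᵇ∧≤ᵇ t in sy′ i≤j j<r-1)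

Typed : ℕ → Pattern → (ℕ → Sym) → Set
Typed n a f = ∀ q → q < n → HasType (suc n) a (suc q) (f q)

Typed⇒Interlacing : ∀ {n a f} → Typed n a f → Interlacing (suc n) a
Typed⇒Interlacing typed (suc q) j _ q<j j≤n =
  HasType⇒interlaced _ (typed q (≤-trans q<j j≤n)) j q<j j≤n

trunc-types⇒Typed : ∀ {n a} (Θ : Fin (suc n) → Sym) →
  (∀ k → HasType (suc n) a (suc (toℕ k)) (trunc Θ k)) → Typed n a (symAt Θ)
trunc-types⇒Typed {n} {a} Θ types q q<n =
  subst (λ q → HasType (suc n) a (suc q) (symAt Θ q)) (toℕ-fromℕ< q<n)
    (subst (HasType (suc n) a _) (sym (symAt-inject₁ Θ k)) (types k))
  where
  k : Fin n
  k = fromℕ< q<n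

Typed⇒trunc-types : ∀ {n a} (Θ : Fin (suc n) → Sym) →
  Typed n a (symAt Θ) → ∀ k → HasType (suc n) a (suc (toℕ k)) (trunc Θ k)
Typed⇒trunc-types Θ typed k = subst (HasType _ _ _) (symAt-inject₁ Θ k) (typed (toℕ k) (toℕ<n k))

bk-Typed : ∀ {n m f g} (a : Pattern) → m < n → f m ≢ f (suc m) → AdjacentSwap m f g →
  Typed n a f → Typed n (bk (suc n) (suc m) a) g
bk-Typed {n} {m} a m<n fm≢fm+1 sw typed q q<n with q ≟ m | q ≟ suc m
... | yes refl | _ =
  subst (HasType _ _ _) (sym at-m) (proj₁ (bk-exchangesTypes n m a fm≢fm+1 (typed q q<n) (typed (suc m))))
  where open AdjacentSwap sw
... | no _ | yes refl =
  subst (HasType _ _ _) (sym at-suc-m) (proj₂ (bk-exchangesTypes n m a fm≢fm+1 (typed m m<n) (typed q)) q<n)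
  where open AdjacentSwap sw
... | no q≢m | no q≢m+1 =
  subst (HasType _ _ _) (sym (AdjacentSwap.elsewhere sw q q≢m q≢m+1))
    (HasType-cong _ (λ j → sym (bk-otherRow (suc n) (suc m) a q j q≢m+1))
                    (λ j → sym (bk-otherRow (suc n) (suc m) a (suc q) j (q≢m ∘ suc-injective)))
                    (typed q q<n))

module _ {n : ℕ} (Θ : Fin (suc n) → Sym) (k : Fin n) (Θₖ≢Θₖ₊₁ : Θ (inject₁ k) ≢ Θ (suc k)) where
  private
    r m i : ℕ
    r = suc n
    m = toℕ k
    i = suc m
    f g : ℕ → Sym
    f = symAt Θ
    g = symAt (swapΘ k Θ)
    Θ′ Θ″ : Fin n → Sym
    Θ′ = trunc Θ
    Θ″ = trunc (swapΘ k Θ)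
    sw : AdjacentSwap m f g
    sw = symAt-swapΘ k Θ
    fm≢fm+1 : f m ≢ f (suc m)
    fm≢fm+1 fm≡fm+1 = Θₖ≢Θₖ₊₁ (trans (sym (symAt-inject₁ Θ k)) (trans fm≡fm+1 (symAt-toℕ Θ (suc k))))

  bk-GTPΘ : ∀ {ν} a → GTPΘ n ν Θ′ a → GTPΘ n ν Θ″ (bk r i a)
  bk-GTPΘ {ν} a ((top , _) , types) =
    (top′ , Typed⇒Interlacing typed′) , Typed⇒trunc-types (swapΘ k Θ) typed′
    where
    typed′ : Typed n (bk r i a) g
    typed′ = bk-Typed a (toℕ<n k) fm≢fm+1 sw (trunc-types⇒Typed Θ types)
    top′ : ∀ j → bk r i a 0 (toℕ j) ≡ ν j
    top′ j = trans (bk-otherRow r i a 0 (toℕ j) (λ ())) (top j)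

  rho-swapΘ : ∀ p j → p ≢ i → p ≤ j → j ≤ n → rho Θ′ p j ≡ rho Θ″ p j
  rho-swapΘ p j p≢i p≤j j≤n = begin
    rho Θ′ p j            ≡⟨ rho-trunc Θ p j p≤j j≤n ⟩
    (n ∸ j) + countΔ f p  ≡⟨ cong ((n ∸ j) +_) (sym (countΔ-swap sw p p≢i)) ⟩
    (n ∸ j) + countΔ g p  ≡⟨ sym (rho-trunc (swapΘ k Θ) p j p≤j j≤n) ⟩
    rho Θ″ p j            ∎
    where open ≡-Reasoning

  bkEntry-sh : ∀ a → Interlacing r a → ∀ j → i ≤ j → j ≤ n →
    bkEntry r i (sh Θ′ a) j ≡ bkEntry r i a j + rho Θ″ i j
  bkEntry-sh a interlacing (suc j) (s≤s m≤j) j<n =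
    bkEntry-shift r i a (rho Θ′) (suc j) aᵢⱼ≤upper
      shift-aboveLeft shift-below shift-above shift-belowRight refl shifts-sum
    where
    open Neighbours r i a
    open AdjacentSwap sw
    c e K : ℕ
    c = n ∸ suc j
    e = countΔ f m
    K = c + e
    step : countΔ f (suc i) ≡ suc e
    step = countΔ-step² f m fm≢fm+1
    shift-aboveLeft : rho Θ′ m j ≡ suc K
    shift-aboveLeft = trans (rho-trunc Θ m j m≤j (<⇒≤ j<n)) (cong (_+ e) (+-∸-assoc 1 j<n))
    shift-below : suc i ≤ suc j → suc j ≤ n → rho Θ′ (suc i) (suc j) ≡ suc K
    shift-below i<j+1 _ =
      trans (rho-trunc Θ (suc i) (suc j) i<j+1 j<n) (trans (cong (c +_) step) (+-suc c e))
    shift-above : rho Θ′ m (suc j) ≡ K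
    shift-above = rho-trunc Θ m (suc j) (m≤n⇒m≤1+n m≤j) j<n
    shift-belowRight : i ≤ suc j → suc (suc j) ≤ n → rho Θ′ (suc i) (suc (suc j)) ≡ K
    shift-belowRight i≤j+1 j+1<n = begin
      rho Θ′ (suc i) (suc (suc j))          ≡⟨ rho-trunc Θ (suc i) (suc (suc j)) (s≤s i≤j+1) j+1<n ⟩
      (n ∸ suc (suc j)) + countΔ f (suc i)  ≡⟨ cong (n ∸ suc (suc j) +_) step ⟩
      (n ∸ suc (suc j)) + suc e             ≡⟨ +-suc (n ∸ suc (suc j)) e ⟩
      suc (n ∸ suc (suc j)) + e             ≡⟨ cong (_+ e) (sym (+-∸-assoc 1 j+1<n)) ⟩
      K                                     ∎
      where open ≡-Reasoning
    countΔ-g-i : countΔ g i ≡ δ (f (suc m)) + e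
    countΔ-g-i = cong₂ _+_ (cong δ at-m) (countΔ-swap sw m (≢-sym 1+n≢n))
    shifts-sum : rho Θ′ i (suc j) + rho Θ″ i (suc j) ≡ suc K + K
    shifts-sum = trans
      (cong₂ _+_ (rho-trunc Θ i (suc j) (s≤s m≤j) j<n)
                 (trans (rho-trunc (swapΘ k Θ) i (suc j) (s≤s m≤j) j<n) (cong (c +_) countΔ-g-i)))
      (complementary-shifts c e (δ-distinct fm≢fm+1))
    aᵢⱼ≤upper : a i (suc j) ≤ upper r i a (suc j)
    aᵢⱼ≤upper = upper-glb (suc j) (proj₁ (interlacing i (suc j) (s≤s z≤n) (s≤s m≤j) j<n))
      (λ i<j+1 _ → proj₂ (interlacing (suc i) (suc j) (s≤s z≤n) i<j+1 j<n))

  bk-sh : ∀ a → Interlacing r a → bk r i (sh Θ′ a) ≈[ r ] sh Θ″ (bk r i a)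
  bk-sh a interlacing p j p≤j j≤n with p ≟ i
  ... | yes refl = begin
    bk r i (sh Θ′ a) i j          ≡⟨ bk-row r i (sh Θ′ a) j ⟩
    bkEntry r i (sh Θ′ a) j       ≡⟨ bkEntry-sh a interlacing j p≤j j≤n ⟩
    bkEntry r i a j + rho Θ″ i j  ≡⟨ cong (_+ rho Θ″ i j) (sym (bk-row r i a j)) ⟩
    bk r i a i j + rho Θ″ i j     ∎
    where open ≡-Reasoning
  ... | no p≢i = trans (bk-otherRow r i (sh Θ′ a) p j p≢i)
    (cong₂ _+_ (sym (bk-otherRow r i a p j p≢i)) (rho-swapΘ p j p≢i p≤j j≤n))

lemma4p6 : (n : ℕ) (ν : Fin (ℕ.suc n) → ℕ) → IsPartition n ν →
    (Θ : Fin (ℕ.suc n) → Sym) (k : Fin n) → Θ (inject₁ k) ≢ Θ (suc k) →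
    (∀ (T : Pattern) → GTPΘ n (plusRho n ν) (trunc Θ) T →
       GTPΘ n (plusRho n ν) (trunc (swapΘ k Θ)) (bk (ℕ.suc n) (ℕ.suc (toℕ k)) T))
    × (∀ (T : Pattern) → GTP (ℕ.suc n) ν T →
       bk (ℕ.suc n) (ℕ.suc (toℕ k)) (sh (trunc Θ) T)
         ≈[ ℕ.suc n ] sh (trunc (swapΘ k Θ)) (bk (ℕ.suc n) (ℕ.suc (toℕ k)) T))
lemma4p6 n ν _ Θ k Θₖ≢Θₖ₊₁ =
  (λ T → bk-GTPΘ Θ k Θₖ≢Θₖ₊₁ T) , (λ T (_ , interlacing) → bk-sh Θ k Θₖ≢Θₖ₊₁ T interlacing)
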